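{- Let $r\ge2$, $\lambda$ a partition with $r$ parts (some possibly zero), $N\ge\lambda_1+r-1$, $\mathbf{z}\in(\mathbb{C}^\times)^r$. Suppose $\lambda_i=\lambda_{i+1}=\cdots=\lambda_j=c$ for some $i<j$. Then in every admissible state of a colored system $\mathfrak{S}_{\mathbf{z},\lambda,w}$, each pair of colored lines that enter through the top boundary edges in columns $c+r-i,\dots,c+r-j$ cross. Consequently, if $\mathfrak{S}_{\mathbf{z},\lambda,w}$ has an admissible state, then $w$ is the shortest element of its coset $wW_\lambda$, where $W_\lambda$ is the stabilizer of $\lambda$ in $W=S_r$.
   Context: Grid: $r$ rows labeled $1,\dots,r$ top to bottom, $N+1$ columns labeled $N,\dots,0$ left to right; each vertex has (left, top, right, bottom) edges. Colors $c_1>\cdots>c_r$; edges carry $+$ or a color. Boundary of $\mathfrak{S}_{\mathbf{z},\lambda,w}$: top boundary edge in column $\lambda_k+r-k$ carries $c_k$, other top edges $+$; left and bottom boundary edges $+$; right boundary edge of row $k$ carries $c_{w^{ -1}(k)}$. A state (assignment to interior edges) is admissible if every vertex has (left, top, right, bottom) of one of the forms $(+,+,+,+)$, $(c,d,\max(c,d),\min(c,d))$, $(c,+,c,+)$, $(c,+,+,c)$, $(+,c,c,+)$ with $c,d$ colors. In an admissible state the edges of a given color form a path (colored line) from the top boundary to the right boundary; two colored lines of colors $c\ne d$ cross at a vertex of the form $(c,d,c,d)$ (which occurs exactly when the left color exceeds the top color). -}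

module Defs where

open import Data.Nat using (ℕ; zero; suc; _+_; _∸_; _≤_; _<_; _≤ᵇ_; _<ᵇ_)
open import Data.Fin using (Fin; toℕ)
open import Data.Fin.Permutation using (Permutation′; _⟨$⟩ʳ_; _⟨$⟩ˡ_)
open import Data.Maybe using (Maybe; just; nothing)
open import Data.Bool using (Bool; true; false; if_then_else_; _∧_)
open import Data.List using (List; map; allFin)
open import Data.Nat.ListAction using (sum)
open import Data.Product using (_×_; ∃; ∃-syntax; _,_)
open import Data.Sum using (_⊎_)
open import Relation.Binary.PropositionalEquality using (_≡_; _≢_)

-- Colours c_1 > c_2 > ... > c_r are represented by their 0-based index
-- k : Fin r (index k stands for c_{k+1}).  A smaller index is a LARGER colour.
-- An edge label is  nothing  (the spin +)  or  just k  (colour c_{k+1}).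
Label : ℕ → Set
Label r = Maybe (Fin r)

maxC : ∀ {r} → Fin r → Fin r → Fin r
maxC c d = if toℕ c ≤ᵇ toℕ d then c else d

minC : ∀ {r} → Fin r → Fin r → Fin r
minC c d = if toℕ c ≤ᵇ toℕ d then d else c

-- Admissible vertex configurations (left, top, right, bottom)
data AdmVertex {r : ℕ} : Label r → Label r → Label r → Label r → Set where
  v-empty : AdmVertex nothing nothing nothing nothing
  v-meet  : (c d : Fin r) → AdmVertex (just c) (just d) (just (maxC c d)) (just (minC c d))
  v-horiz : (c : Fin r) → AdmVertex (just c) nothing (just c) nothing
  v-turnD : (c : Fin r) → AdmVertex (just c) nothing nothing (just c)
  v-turnR : (c : Fin r) → AdmVertex nothing (just c) (just c) nothing

-- A state on the grid with r rows (0-based i = 0..r-1, paper row i+1) and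
-- columns labelled N,...,0 from left to right.
--   hor i j : horizontal edge in row i lying immediately to the LEFT of the
--             vertex in column j (j = 0..N+1); so vertex (i,j) has left edge
--             hor i (suc j) and right edge hor i j; hor i (suc N) is the left
--             boundary edge, hor i 0 the right boundary edge of row i.
--   ver t j : vertical edge in column j lying immediately ABOVE row t
--             (t = 0..r); vertex (i,j) has top edge ver i j and bottom edge
--             ver (suc i) j; ver 0 j is the top boundary, ver r j the bottom one.
-- Values outside these ranges are irrelevant.
record State (r : ℕ) : Set where
  constructor state
  field
    hor : ℕ → ℕ → Label r
    ver : ℕ → ℕ → Label r
open State public

-- column of the top boundary edge carrying colour c_{k+1}:  λ_{k+1} + r - (k+1)
topCol : ∀ {r} → (Fin r → ℕ) → Fin r → ℕ
topCol {r} λ′ k = λ′ k + (r ∸ suc (toℕ k))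

-- Admissible states of the system S_{z,λ,w}
-- (the spectral parameters z only enter Boltzmann weights, not admissibility)
Admissible : (r N : ℕ) → (Fin r → ℕ) → Permutation′ r → State r → Set
Admissible r N λ′ w s =
    (∀ (i : Fin r) j → j ≤ N →
       AdmVertex (hor s (toℕ i) (suc j)) (ver s (toℕ i) j) (hor s (toℕ i) j) (ver s (suc (toℕ i)) j))
  × (∀ j → j ≤ N → ∀ (k : Fin r) → j ≡ topCol λ′ k → ver s 0 j ≡ just k)
  × (∀ j → j ≤ N → (∀ (k : Fin r) → j ≢ topCol λ′ k) → ver s 0 j ≡ nothing)
  × (∀ j → j ≤ N → ver s r j ≡ nothing)
  × (∀ (i : Fin r) → hor s (toℕ i) (suc N) ≡ nothing)
  × (∀ (i : Fin r) → hor s (toℕ i) 0 ≡ just (w ⟨$⟩ˡ i))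

Cross : (r N : ℕ) → State r → Fin r → Fin r → Set
Cross r N s k l =
  ∃[ i ] ∃[ j ] (i < r × j ≤ N ×
    ( (hor s i (suc j) ≡ just k × ver s i j ≡ just l × hor s i j ≡ just k × ver s (suc i) j ≡ just l)
    ⊎ (hor s i (suc j) ≡ just l × ver s i j ≡ just k × hor s i j ≡ just l × ver s (suc i) j ≡ just k)))

IsPartition : ∀ {r} → (Fin r → ℕ) → Set
IsPartition {r} λ′ = ∀ (a b : Fin r) → toℕ a ≤ toℕ b → λ′ b ≤ λ′ a

inversions : ∀ {r} → (Fin r → Fin r) → ℕ
inversions {r} f =
  sum (map (λ a → sum (map (λ b →
    if (toℕ a <ᵇ toℕ b) ∧ (toℕ (f b) <ᵇ toℕ (f a)) then 1 else 0) (allFin r))) (allFin r))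

len : ∀ {r} → Permutation′ r → ℕ
len w = inversions (w ⟨$⟩ʳ_)

InStabilizer : ∀ {r} → (Fin r → ℕ) → Permutation′ r → Set
InStabilizer λ′ σ = ∀ m → λ′ (σ ⟨$⟩ʳ m) ≡ λ′ m

ShortestInCoset : ∀ {r} → (Fin r → ℕ) → Permutation′ r → Set
ShortestInCoset λ′ w = ∀ σ → InStabilizer λ′ σ →
  len w ≤ inversions (λ m → w ⟨$⟩ʳ (σ ⟨$⟩ʳ m))

-- Within a block of equal parts the entry columns of the colours are consecutive, so
-- between the lines of two of its colours k > l (k entering to the left of l) every
-- vertical edge is coloured.  Sweeping row by row, this is preserved: along a row the
-- horizontal edges between the two lines carry colours ≥ k, so below the row every
-- edge between them is again coloured and l simply goes straight down, unless k itself
-- runs along the row up to l, where the two lines cross.  After the crossing the larger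
-- colour k stays to the right of l, so k leaves the grid through a higher row than l;
-- hence w is increasing on every level set of λ, which makes it shortest in w W_λ.
module Submission where

open import Defs
open import Data.Nat
  using (ℕ; zero; suc; _+_; _∸_; _≤_; _<_; _≤ᵇ_; _<ᵇ_; z≤n; s≤s; s≤s⁻¹; _≤?_; _<?_)
open import Data.Nat.Properties
open import Data.Fin using (Fin; zero; suc; toℕ; fromℕ<; opposite)
open import Data.Fin.Properties using (toℕ-fromℕ<; toℕ<n; opposite-prop; opposite-involutive)
open import Data.Fin.Permutation using (Permutation′; _⟨$⟩ʳ_; _⟨$⟩ˡ_; inverseʳ; inverseˡ)
open import Data.Maybe using (nothing; just)
open import Data.Maybe.Properties using (just-injective)
open import Data.Bool using (Bool; true; false; if_then_else_; _∧_; T)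
open import Data.Bool.Properties using (T-∧)
open import Data.List using (map; allFin; tabulate)
open import Data.List.Properties using (map-tabulate)
open import Data.Nat.ListAction using (sum)
open import Data.Product using (_×_; _,_; proj₁; proj₂; Σ; ∃-syntax)
open import Data.Sum using (_⊎_; inj₁; inj₂)
open import Data.Empty using (⊥; ⊥-elim)
open import Function using (id; Equivalence)
open import Relation.Nullary using (¬_; yes; no)
open import Relation.Binary.PropositionalEquality
open import Algebra.Properties.CommutativeMonoid.Sum +-0-commutativeMonoid
  using (sum-cong-≗; sum-permute) renaming (sum to ∑)

maxC-≤ : ∀ {r} {c d : Fin r} → toℕ c ≤ toℕ d → maxC c d ≡ c
maxC-≤ {c = c} {d} c≤d with toℕ c ≤ᵇ toℕ d | ≤⇒≤ᵇ c≤d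
... | true | _ = refl

minC-≤ : ∀ {r} {c d : Fin r} → toℕ c ≤ toℕ d → minC c d ≡ d
minC-≤ {c = c} {d} c≤d with toℕ c ≤ᵇ toℕ d | ≤⇒≤ᵇ c≤d
... | true | _ = refl

maxC-> : ∀ {r} {c d : Fin r} → toℕ d < toℕ c → maxC c d ≡ d
maxC-> {c = c} {d} d<c with toℕ c ≤ᵇ toℕ d | ≤ᵇ⇒≤ (toℕ c) (toℕ d)
... | true  | c≤d = ⊥-elim (<⇒≱ d<c (c≤d _))
... | false | _   = refl

minC-> : ∀ {r} {c d : Fin r} → toℕ d < toℕ c → minC c d ≡ c
minC-> {c = c} {d} d<c with toℕ c ≤ᵇ toℕ d | ≤ᵇ⇒≤ (toℕ c) (toℕ d)
... | true  | c≤d = ⊥-elim (<⇒≱ d<c (c≤d _))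
... | false | _   = refl

Coloured : ∀ {r} → Label r → Set
Coloured e = ∃[ d ] e ≡ just d

ColouredOn : ∀ {r} → (ℕ → Label r) → ℕ → ℕ → Set
ColouredOn v a b = ∀ m → a ≤ m → m < b → Coloured (v m)

ColouredOn-empty : ∀ {r} {v : ℕ → Label r} {a} → ColouredOn v a a
ColouredOn-empty m a≤m m<a = ⊥-elim (<⇒≱ m<a a≤m)

ColouredOn-extend : ∀ {r} {v : ℕ → Label r} {a b} →
                    Coloured (v a) → ColouredOn v (suc a) b → ColouredOn v a b
ColouredOn-extend va vab m a≤m m<b with m≤n⇒m<n∨m≡n a≤m
... | inj₁ a<m  = vab m a<m m<b
... | inj₂ refl = va

module _ {r : ℕ} {L T R B : Label r} where

  enter-top : ∀ {d} → AdmVertex L T R B → L ≡ nothing → T ≡ just d → R ≡ just d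
  enter-top (v-turnR _) refl refl = refl
  enter-top v-empty     _    ()
  enter-top (v-meet _ _) ()  _
  enter-top (v-horiz _) ()   _
  enter-top (v-turnD _) ()   _

  meet-≤ : ∀ {c d} → AdmVertex L T R B → L ≡ just c → T ≡ just d → toℕ c ≤ toℕ d →
           R ≡ just c × B ≡ just d
  meet-≤ (v-meet _ _) refl refl c≤d = cong just (maxC-≤ c≤d) , cong just (minC-≤ c≤d)
  meet-≤ v-empty     ()   _ _
  meet-≤ (v-horiz _) _    () _
  meet-≤ (v-turnD _) _    () _
  meet-≤ (v-turnR _) ()   _ _

  meet-> : ∀ {c d} → AdmVertex L T R B → L ≡ just c → T ≡ just d → toℕ d < toℕ c →
           R ≡ just d × B ≡ just c
  meet-> (v-meet _ _) refl refl d<c = cong just (maxC-> d<c) , cong just (minC-> d<c)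
  meet-> v-empty     ()   _ _
  meet-> (v-horiz _) _    () _
  meet-> (v-turnD _) _    () _
  meet-> (v-turnR _) ()   _ _

  meet-max : ∀ {c d} → AdmVertex L T R B → L ≡ just c → T ≡ just d →
             (∃[ c′ ] R ≡ just c′ × toℕ c′ ≤ toℕ c) × Coloured B
  meet-max {c} {d} v lc td with toℕ c ≤? toℕ d
  ... | yes c≤d = let (rc , bd) = meet-≤ v lc td c≤d in (c , rc , ≤-refl) , (d , bd)
  ... | no  c≰d = let (rd , bc) = meet-> v lc td (≰⇒> c≰d) in (d , rd , <⇒≤ (≰⇒> c≰d)) , (c , bc)

  left-continues : ∀ {e} → AdmVertex L T R B → L ≡ just e → R ≡ just e ⊎ B ≡ just e
  left-continues (v-meet c d) refl with toℕ c ≤? toℕ d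
  ... | yes c≤d = inj₁ (cong just (maxC-≤ c≤d))
  ... | no  c≰d = inj₂ (cong just (minC-> (≰⇒> c≰d)))
  left-continues (v-horiz _) refl = inj₁ refl
  left-continues (v-turnD _) refl = inj₂ refl
  left-continues v-empty     ()
  left-continues (v-turnR _) ()

  top-continues : ∀ {e} → AdmVertex L T R B → T ≡ just e → R ≡ just e ⊎ B ≡ just e
  top-continues (v-meet c d) refl with toℕ c ≤? toℕ d
  ... | yes c≤d = inj₂ (cong just (minC-≤ c≤d))
  ... | no  c≰d = inj₁ (cong just (maxC-> (≰⇒> c≰d)))
  top-continues (v-turnR _) refl = inj₁ refl
  top-continues v-empty     ()
  top-continues (v-horiz _) ()
  top-continues (v-turnD _) ()

opposite-cancel-< : ∀ {r} {a b : Fin r} → toℕ (opposite a) < toℕ (opposite b) → toℕ b < toℕ a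
opposite-cancel-< {r} {a} {b} oa<ob =
  s≤s⁻¹ (∸-cancelʳ-< {o = r} (subst₂ _<_ (opposite-prop a) (opposite-prop b) oa<ob))

topCol-≤ : ∀ {r N} {λ′ : Fin r → ℕ} → IsPartition λ′ →
           (∀ (z : Fin r) → toℕ z ≡ 0 → λ′ z + (r ∸ 1) ≤ N) → ∀ k → topCol λ′ k ≤ N
topCol-≤ {suc r} part hN k =
  ≤-trans (+-mono-≤ (part zero k z≤n) (∸-monoʳ-≤ {n = suc (toℕ k)} (suc r) (s≤s z≤n))) (hN zero refl)

module _ {r} (λ′ : Fin r → ℕ) {k l : Fin r} {c : ℕ}
  (block : ∀ m → toℕ k ≤ toℕ m → toℕ m ≤ toℕ l → λ′ m ≡ c) where

  topCol-block : ∀ {m} → toℕ k ≤ toℕ m → toℕ m ≤ toℕ l → topCol λ′ m ≡ c + toℕ (opposite m)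
  topCol-block k≤m m≤l = cong₂ _+_ (block _ k≤m m≤l) (sym (opposite-prop _))

  topCol-< : toℕ k < toℕ l → topCol λ′ l < topCol λ′ k
  topCol-< k<l =
    subst₂ _<_ (sym (topCol-block (<⇒≤ k<l) ≤-refl)) (sym (topCol-block ≤-refl (<⇒≤ k<l)))
      (+-monoʳ-< c (subst₂ _<_ (sym (opposite-prop l)) (sym (opposite-prop k))
                              (∸-monoʳ-< (s≤s k<l) (toℕ<n l))))

  -- the columns c + toℕ (opposite m) of the block are consecutive
  topCol-between : toℕ k < toℕ l → ∀ j → topCol λ′ l < j → j < topCol λ′ k →
                   ∃[ x ] j ≡ topCol λ′ x
  topCol-between k<l j l<j j<k = x , j≡topCol-x
    where
    ol<j : c + toℕ (opposite l) < j
    ol<j = subst (_< j) (topCol-block (<⇒≤ k<l) ≤-refl) l<j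
    j<ok : j < c + toℕ (opposite k)
    j<ok = subst (j <_) (topCol-block ≤-refl (<⇒≤ k<l)) j<k
    j≡c+e : j ≡ c + (j ∸ c)
    j≡c+e = sym (m+[n∸m]≡n (≤-trans (m≤m+n c _) (<⇒≤ ol<j)))
    ol<e : toℕ (opposite l) < j ∸ c
    ol<e = +-cancelˡ-< c _ _ (subst (c + toℕ (opposite l) <_) j≡c+e ol<j)
    e<ok : j ∸ c < toℕ (opposite k)
    e<ok = +-cancelˡ-< c _ _ (subst (_< c + toℕ (opposite k)) j≡c+e j<ok)
    x : Fin r
    x = opposite (fromℕ< (<-trans e<ok (toℕ<n (opposite k))))
    ox≡e : toℕ (opposite x) ≡ j ∸ c
    ox≡e = trans (cong toℕ (opposite-involutive _)) (toℕ-fromℕ< _)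
    j≡topCol-x : j ≡ topCol λ′ x
    j≡topCol-x = begin
      j                       ≡⟨ j≡c+e ⟩
      c + (j ∸ c)             ≡⟨ cong (c +_) ox≡e ⟨
      c + toℕ (opposite x)    ≡⟨ topCol-block k≤x x≤l ⟨
      topCol λ′ x             ∎
      where
      open ≡-Reasoning
      k≤x = <⇒≤ (opposite-cancel-< (subst (_< toℕ (opposite k)) (sym ox≡e) e<ok))
      x≤l = <⇒≤ (opposite-cancel-< (subst (toℕ (opposite l) <_) (sym ox≡e) ol<e))

-- Following two coloured lines through the grid

sweep : ∀ {r} {P : ℕ → Set} {Q : Set} → (∀ {t} → t < r → P t → Q ⊎ P (suc t)) → ¬ P r →
        ∀ {t} → t ≤ r → P t → Q
sweep {r} {P} {Q} step stop {t} t≤r = go (r ∸ t) (m∸n+n≡m t≤r)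
  where
  go : ∀ n {t} → n + t ≡ r → P t → Q
  go zero refl p = ⊥-elim (stop p)
  go (suc n) {t} n+t≡r p with step (subst (t <_) n+t≡r (m<n+m t (s≤s z≤n))) p
  ... | inj₁ q  = q
  ... | inj₂ p′ = go n {suc t} (trans (+-suc n t) n+t≡r) p′

module Lines {r N : ℕ} (s : State r)
  (vertex : ∀ (i : Fin r) j → j ≤ N →
     AdmVertex (hor s (toℕ i) (suc j)) (ver s (toℕ i) j) (hor s (toℕ i) j) (ver s (suc (toℕ i)) j))
  (bottom : ∀ j → j ≤ N → ver s r j ≡ nothing)
  where

  vertexAt : ∀ {t j} → t < r → j ≤ N →
             AdmVertex (hor s t (suc j)) (ver s t j) (hor s t j) (ver s (suc t) j)
  vertexAt {j = j} t<r j≤N =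
    subst (λ t → AdmVertex (hor s t (suc j)) (ver s t j) (hor s t j) (ver s (suc t) j))
          (toℕ-fromℕ< t<r) (vertex (fromℕ< t<r) j j≤N)

  nothing-below : ∀ {j e} → j ≤ N → ver s r j ≡ just e → ⊥
  nothing-below j≤N ej with () ← trans (sym (bottom _ j≤N)) ej

  followRow : ∀ {t b p e} → t < r → b ≤ p → p ≤ N → hor s t p ≡ just e →
              hor s t b ≡ just e ⊎ ∃[ q ] b ≤ q × q < p × ver s (suc t) q ≡ just e
  followRow {p = zero} _ z≤n _ ep = inj₁ ep
  followRow {b = b} {suc p} t<r b≤p′ p′≤N ep with m≤n⇒m<n∨m≡n b≤p′
  ... | inj₂ refl = inj₁ ep
  ... | inj₁ b<p′ with left-continues (vertexAt t<r (<⇒≤ p′≤N)) ep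
  ...   | inj₂ down  = inj₂ (p , s≤s⁻¹ b<p′ , ≤-refl , down)
  ...   | inj₁ right with followRow t<r (s≤s⁻¹ b<p′) (<⇒≤ p′≤N) right
  ...     | inj₁ eb = inj₁ eb
  ...     | inj₂ (q , b≤q , q<p , eq) = inj₂ (q , b≤q , m<n⇒m<1+n q<p , eq)

  module Pair {k l : Fin r} (k<l : toℕ k < toℕ l) where

    data ExitsAbove : Set where
      exitRows : ∀ {tₖ tₗ} → tₖ < tₗ → tₗ < r →
                 hor s tₖ 0 ≡ just k → hor s tₗ 0 ≡ just l → ExitsAbove

    data RightOf (t : ℕ) : Set where
      both   : ∀ {Y X} → ver s t Y ≡ just k → ver s t X ≡ just l → Y < X → X ≤ N → RightOf t
      exited : ∀ {t′ X} → t′ < t → hor s t′ 0 ≡ just k → ver s t X ≡ just l → X ≤ N → RightOf t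

    rightOf-fromRow : ∀ {t p X} → t < r → p ≤ X → X ≤ N → hor s t p ≡ just k →
                      ver s (suc t) X ≡ just l → RightOf (suc t)
    rightOf-fromRow {t} t<r p≤X X≤N kp lX with followRow t<r z≤n (≤-trans p≤X X≤N) kp
    ... | inj₁ kExit = exited (n<1+n t) kExit lX X≤N
    ... | inj₂ (q , _ , q<p , kq) = both kq lX (<-≤-trans q<p p≤X) X≤N

    rightOf-fromTop : ∀ {t Y X} → t < r → Y < X → X ≤ N → ver s t Y ≡ just k →
                      ver s (suc t) X ≡ just l → RightOf (suc t)
    rightOf-fromTop t<r Y<X X≤N kY lX with top-continues (vertexAt t<r (≤-trans (<⇒≤ Y<X) X≤N)) kY
    ... | inj₁ right = rightOf-fromRow t<r (<⇒≤ Y<X) X≤N right lX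
    ... | inj₂ down  = both down lX Y<X X≤N

    -- if l runs into k from the left, the larger colour k takes the right edge
    rightOf-step : ∀ {t} → t < r → RightOf t → ExitsAbove ⊎ RightOf (suc t)
    rightOf-step t<r (both {Y} {X} kY lX Y<X X≤N) with top-continues (vertexAt t<r X≤N) lX
    ... | inj₂ down = inj₂ (rightOf-fromTop t<r Y<X X≤N kY down)
    ... | inj₁ right with followRow t<r Y<X X≤N right
    ...   | inj₂ (q , Y<q , q<X , lq) = inj₂ (rightOf-fromTop t<r Y<q (≤-trans (<⇒≤ q<X) X≤N) kY lq)
    ...   | inj₁ lY = let Y≤N = ≤-trans (<⇒≤ Y<X) X≤N
                          (kY′ , lY′) = meet-> (vertexAt t<r Y≤N) lY kY k<l
                      in inj₂ (rightOf-fromRow t<r ≤-refl Y≤N kY′ lY′)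
    rightOf-step {t} t<r (exited t′<t kExit lX X≤N) with top-continues (vertexAt t<r X≤N) lX
    ... | inj₂ down = inj₂ (exited (m<n⇒m<1+n t′<t) kExit down X≤N)
    ... | inj₁ right with followRow t<r z≤n X≤N right
    ...   | inj₁ lExit = inj₁ (exitRows t′<t t<r kExit lExit)
    ...   | inj₂ (q , _ , q<X , lq) =
      inj₂ (exited (m<n⇒m<1+n t′<t) kExit lq (≤-trans (<⇒≤ q<X) X≤N))

    rightOf-bottom : ¬ RightOf r
    rightOf-bottom (both _ lX _ X≤N)   = nothing-below X≤N lX
    rightOf-bottom (exited _ _ lX X≤N) = nothing-below X≤N lX

    rightOf⇒exitsAbove : ∀ {t} → t ≤ r → RightOf t → ExitsAbove
    rightOf⇒exitsAbove = sweep rightOf-step rightOf-bottom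

    data Between (t : ℕ) : Set where
      between : ∀ {Y X} → ver s t Y ≡ just k → ver s t X ≡ just l → X < Y → Y ≤ N →
                ColouredOn (ver s t) (suc X) Y → Between t

    between-top : ∀ {λ′ : Fin r → ℕ} {c} →
                  (∀ j → j ≤ N → ∀ (x : Fin r) → j ≡ topCol λ′ x → ver s 0 j ≡ just x) →
                  (∀ m → toℕ k ≤ toℕ m → toℕ m ≤ toℕ l → λ′ m ≡ c) → topCol λ′ k ≤ N → Between 0
    between-top {λ′} top block Y≤N = between (top _ Y≤N k refl) (top _ X≤N l refl) X<Y Y≤N coloured
      where
      X<Y = topCol-< λ′ block k<l
      X≤N = ≤-trans (<⇒≤ X<Y) Y≤N
      coloured : ColouredOn (ver s 0) (suc (topCol λ′ l)) (topCol λ′ k)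
      coloured j X<j j<Y = let (x , j≡x) = topCol-between λ′ block k<l j X<j j<Y
                           in x , top j (≤-trans (<⇒≤ j<Y) Y≤N) x j≡x

    -- state of k when row t is read from column Y (where k enters it) rightwards up to edge p
    data Scan (t Y p : ℕ) : Set where
      running : hor s t p ≡ just k → Scan t Y p
      turned  : ∀ {c Z} → hor s t p ≡ just c → toℕ c ≤ toℕ k → p ≤ Z → Z ≤ Y →
                ver s (suc t) Z ≡ just k → ColouredOn (ver s (suc t)) p Z → Scan t Y p

    scan-start : ∀ {t Y} → t < r → Y ≤ N → ver s t Y ≡ just k → Scan t Y Y
    scan-start {t} {Y} t<r Y≤N kY with hor s t (suc Y) in eY
    ... | nothing = running (enter-top (vertexAt t<r Y≤N) eY kY)
    ... | just a with toℕ a ≤? toℕ k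
    ...   | yes a≤k = let (aY , kY′) = meet-≤ (vertexAt t<r Y≤N) eY kY a≤k
                      in turned aY a≤k ≤-refl ≤-refl kY′ ColouredOn-empty
    ...   | no  a≰k = running (proj₁ (meet-> (vertexAt t<r Y≤N) eY kY (≰⇒> a≰k)))

    scan-step : ∀ {t Y q} → t < r → q < Y → Y ≤ N → Coloured (ver s t q) → Scan t Y (suc q) → Scan t Y q
    scan-step t<r q<Y Y≤N (d , dq) (running kq) with toℕ k ≤? toℕ d
    ... | yes k≤d = running (proj₁ (meet-≤ (vertexAt t<r (≤-trans (<⇒≤ q<Y) Y≤N)) kq dq k≤d))
    ... | no  k≰d = let (dq′ , kq′) = meet-> (vertexAt t<r (≤-trans (<⇒≤ q<Y) Y≤N)) kq dq (≰⇒> k≰d)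
                    in turned dq′ (<⇒≤ (≰⇒> k≰d)) ≤-refl (<⇒≤ q<Y) kq′ ColouredOn-empty
    scan-step t<r q<Y Y≤N (d , dq) (turned cq c≤k q<Z Z≤Y kZ colZ)
      with meet-max (vertexAt t<r (≤-trans (<⇒≤ q<Y) Y≤N)) cq dq
    ... | (c′ , c′q , c′≤c) , below =
      turned c′q (≤-trans c′≤c c≤k) (<⇒≤ q<Z) Z≤Y kZ (ColouredOn-extend below colZ)

    scan : ∀ {t Y X} → t < r → Y ≤ N → ver s t Y ≡ just k → ColouredOn (ver s t) (suc X) Y →
           ∀ n {p} → n + p ≡ Y → X < p → Scan t Y p
    scan t<r Y≤N kY _ zero refl _ = scan-start t<r Y≤N kY
    scan t<r Y≤N kY col (suc n) {p} n+p≡Y X<p =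
      scan-step t<r p<Y Y≤N (col p X<p p<Y) (scan t<r Y≤N kY col n n+1+p≡Y (m<n⇒m<1+n X<p))
      where
      p<Y = subst (p <_) n+p≡Y (m<n+m p (s≤s z≤n))
      n+1+p≡Y = trans (+-suc n p) n+p≡Y

    between-step : ∀ {t} → t < r → Between t → Between (suc t) ⊎ (Cross r N s k l × RightOf (suc t))
    between-step {t} t<r (between {Y} {X} kY lX X<Y Y≤N col)
      with scan t<r Y≤N kY col (Y ∸ suc X) (m∸n+n≡m X<Y) ≤-refl
    ... | running kX =
      let X≤N = ≤-trans (<⇒≤ X<Y) Y≤N
          (kX′ , lX′) = meet-≤ (vertexAt t<r X≤N) kX lX (<⇒≤ k<l)
      in inj₂ ( (t , X , t<r , X≤N , inj₁ (kX , lX , kX′ , lX′))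
              , rightOf-fromRow t<r ≤-refl X≤N kX′ lX′)
    ... | turned cX c≤k X<Z Z≤Y kZ colZ =
      let lX′ = proj₂ (meet-≤ (vertexAt t<r (≤-trans (<⇒≤ X<Y) Y≤N)) cX lX (≤-trans c≤k (<⇒≤ k<l)))
      in inj₁ (between kZ lX′ X<Z (≤-trans Z≤Y Y≤N) colZ)

    between-bottom : ¬ Between r
    between-bottom (between _ lX X<Y Y≤N _) = nothing-below (≤-trans (<⇒≤ X<Y) Y≤N) lX

    between⇒cross×exitsAbove : ∀ {t} → t ≤ r → Between t → Cross r N s k l × ExitsAbove
    between⇒cross×exitsAbove t≤r b =
      let (cross , t′ , t′≤r , kRight) = sweep step between-bottom t≤r b
      in cross , rightOf⇒exitsAbove t′≤r kRight
      where
      step : ∀ {t} → t < r → Between t →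
             (Cross r N s k l × ∃[ t′ ] t′ ≤ r × RightOf t′) ⊎ Between (suc t)
      step t<r b with between-step t<r b
      ... | inj₁ b′ = inj₂ b′
      ... | inj₂ (cross , kRight) = inj₁ (cross , _ , t<r , kRight)

-- Counting inversions

indicator : Bool → ℕ
indicator b = if b then 1 else 0

indicator-mono : ∀ {b b′} → (T b → T b′) → indicator b ≤ indicator b′
indicator-mono {false}         _    = z≤n
indicator-mono {true} {true}   _    = ≤-refl
indicator-mono {true} {false}  b⇒b′ = ⊥-elim (b⇒b′ _)

∑-mono-≤ : ∀ {n} {g h : Fin n → ℕ} → (∀ i → g i ≤ h i) → ∑ g ≤ ∑ h
∑-mono-≤ {zero}  _   = z≤n
∑-mono-≤ {suc n} g≤h = +-mono-≤ (g≤h _) (∑-mono-≤ (λ i → g≤h (suc i)))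

sum-allFin : ∀ {n} (g : Fin n → ℕ) → sum (map g (allFin n)) ≡ ∑ g
sum-allFin g = trans (cong sum (map-tabulate id g)) (sum-tabulate g)
  where
  sum-tabulate : ∀ {n} (g : Fin n → ℕ) → sum (tabulate g) ≡ ∑ g
  sum-tabulate {zero}  g = refl
  sum-tabulate {suc n} g = cong (g _ +_) (sum-tabulate (λ i → g (suc i)))

countPairs : ∀ {n} → (Fin n → Fin n → Bool) → ℕ
countPairs p = ∑ (λ a → ∑ (λ b → indicator (p a b)))

countPairs-mono : ∀ {n} {p q : Fin n → Fin n → Bool} → (∀ a b → T (p a b) → T (q a b)) →
                  countPairs p ≤ countPairs q
countPairs-mono p⇒q = ∑-mono-≤ (λ a → ∑-mono-≤ (λ b → indicator-mono (p⇒q a b)))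

countPairs-cong : ∀ {n} {p q : Fin n → Fin n → Bool} → (∀ a b → p a b ≡ q a b) →
                  countPairs p ≡ countPairs q
countPairs-cong p≡q = sum-cong-≗ (λ a → sum-cong-≗ (λ b → cong indicator (p≡q a b)))

countPairs-permute : ∀ {n} (p : Fin n → Fin n → Bool) (σ : Permutation′ n) →
                     countPairs p ≡ countPairs (λ a b → p (σ ⟨$⟩ʳ a) (σ ⟨$⟩ʳ b))
countPairs-permute {n} p σ =
  trans (sum-permute (λ a → ∑ (pairedWith a)) σ)
        (sum-cong-≗ (λ a → sum-permute (pairedWith (σ ⟨$⟩ʳ a)) σ))
  where
  pairedWith : Fin n → Fin n → ℕ
  pairedWith a b = indicator (p a b)

discordant : ∀ {n} → (Fin n → Fin n) → (Fin n → Fin n) → Fin n → Fin n → Bool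
discordant g f a b = (toℕ (g a) <ᵇ toℕ (g b)) ∧ (toℕ (f b) <ᵇ toℕ (f a))

inversions≡countPairs : ∀ {n} (f : Fin n → Fin n) → inversions f ≡ countPairs (discordant id f)
inversions≡countPairs {n} f =
  trans (sum-allFin (λ a → sum (map (inverted a) (allFin n))))
        (sum-cong-≗ (λ a → sum-allFin (inverted a)))
  where
  inverted : Fin n → Fin n → ℕ
  inverted a b = indicator (discordant id f a b)

inversions-∘-≥ : ∀ {n} (f : Fin n → Fin n) (σ : Permutation′ n) →
                 (∀ a b → toℕ a < toℕ b → toℕ (f b) < toℕ (f a) → toℕ (σ ⟨$⟩ˡ a) < toℕ (σ ⟨$⟩ˡ b)) →
                 inversions f ≤ inversions (λ m → f (σ ⟨$⟩ʳ m))
inversions-∘-≥ {n} f σ σ⁻¹-keeps-inversions = begin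
  inversions f                                                        ≡⟨ inversions≡countPairs f ⟩
  countPairs (discordant id f)                                        ≤⟨ countPairs-mono keeps ⟩
  countPairs (discordant (σ ⟨$⟩ˡ_) f)                                 ≡⟨ countPairs-permute _ σ ⟩
  countPairs (λ a b → discordant (σ ⟨$⟩ˡ_) f (σ ⟨$⟩ʳ a) (σ ⟨$⟩ʳ b))  ≡⟨ countPairs-cong cancel ⟩
  countPairs (discordant id f∘σ)                                      ≡⟨ inversions≡countPairs f∘σ ⟨
  inversions f∘σ                                                      ∎
  where
  open ≤-Reasoning
  f∘σ : Fin n → Fin n
  f∘σ m = f (σ ⟨$⟩ʳ m)
  keeps : ∀ a b → T (discordant id f a b) → T (discordant (σ ⟨$⟩ˡ_) f a b)
  keeps a b ab = let (a<b , fb<fa) = Equivalence.to T-∧ ab in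
    Equivalence.from T-∧
      (<⇒<ᵇ (σ⁻¹-keeps-inversions a b (<ᵇ⇒< _ _ a<b) (<ᵇ⇒< _ _ fb<fa)) , fb<fa)
  cancel : ∀ a b → discordant (σ ⟨$⟩ˡ_) f (σ ⟨$⟩ʳ a) (σ ⟨$⟩ʳ b) ≡ discordant id f∘σ a b
  cancel a b = cong₂ (λ x y → (toℕ x <ᵇ toℕ y) ∧ (toℕ (f∘σ b) <ᵇ toℕ (f∘σ a)))
                      (inverseˡ σ) (inverseˡ σ)

-- σ ∈ W_λ preserves levels, so it cannot undo an inversion of w, which lies across two levels
shortestInCoset : ∀ {r} {λ′ : Fin r → ℕ} {w : Permutation′ r} → IsPartition λ′ →
                  (∀ a b → toℕ a < toℕ b → λ′ a ≡ λ′ b → toℕ (w ⟨$⟩ʳ a) < toℕ (w ⟨$⟩ʳ b)) →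
                  ShortestInCoset λ′ w
shortestInCoset {λ′ = λ′} {w} part increasing σ stab = inversions-∘-≥ (w ⟨$⟩ʳ_) σ keeps
  where
  λ∘σ⁻¹ : ∀ a → λ′ (σ ⟨$⟩ˡ a) ≡ λ′ a
  λ∘σ⁻¹ a = trans (sym (stab (σ ⟨$⟩ˡ a))) (cong λ′ (inverseʳ σ))
  keeps : ∀ a b → toℕ a < toℕ b → toℕ (w ⟨$⟩ʳ b) < toℕ (w ⟨$⟩ʳ a) →
          toℕ (σ ⟨$⟩ˡ a) < toℕ (σ ⟨$⟩ˡ b)
  keeps a b a<b wb<wa with toℕ (σ ⟨$⟩ˡ a) <? toℕ (σ ⟨$⟩ˡ b)
  ... | yes σ⁻¹a<σ⁻¹b = σ⁻¹a<σ⁻¹b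
  ... | no  σ⁻¹a≮σ⁻¹b = ⊥-elim (<-asym wb<wa (increasing a b a<b λa≡λb))
    where
    λa≡λb = ≤-antisym (subst₂ _≤_ (λ∘σ⁻¹ a) (λ∘σ⁻¹ b) (part _ _ (≮⇒≥ σ⁻¹a≮σ⁻¹b)))
                      (part a b (<⇒≤ a<b))

module AdmissibleState {r N : ℕ} {λ′ : Fin r → ℕ} (w : Permutation′ r) (s : State r)
  (part : IsPartition λ′) (hN : ∀ (z : Fin r) → toℕ z ≡ 0 → λ′ z + (r ∸ 1) ≤ N)
  (vertex : ∀ (i : Fin r) j → j ≤ N →
     AdmVertex (hor s (toℕ i) (suc j)) (ver s (toℕ i) j) (hor s (toℕ i) j) (ver s (suc (toℕ i)) j))
  (top : ∀ j → j ≤ N → ∀ (k : Fin r) → j ≡ topCol λ′ k → ver s 0 j ≡ just k)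
  (bottom : ∀ j → j ≤ N → ver s r j ≡ nothing)
  (right : ∀ (i : Fin r) → hor s (toℕ i) 0 ≡ just (w ⟨$⟩ˡ i))
  where

  open Lines s vertex bottom

  block⇒cross×exitsAbove : ∀ {k l c} (k<l : toℕ k < toℕ l) →
                           (∀ m → toℕ k ≤ toℕ m → toℕ m ≤ toℕ l → λ′ m ≡ c) →
                           Cross r N s k l × Pair.ExitsAbove k<l
  block⇒cross×exitsAbove {k} k<l block =
    Pair.between⇒cross×exitsAbove k<l z≤n (Pair.between-top k<l top block (topCol-≤ part hN k))

  w-exitRow : ∀ {t e} → t < r → hor s t 0 ≡ just e → toℕ (w ⟨$⟩ʳ e) ≡ t
  w-exitRow {t} {e} t<r et = begin
    toℕ (w ⟨$⟩ʳ e)            ≡⟨ cong (λ x → toℕ (w ⟨$⟩ʳ x)) wi≡e ⟨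
    toℕ (w ⟨$⟩ʳ (w ⟨$⟩ˡ i))    ≡⟨ cong toℕ (inverseʳ w) ⟩
    toℕ i                      ≡⟨ toℕ-fromℕ< t<r ⟩
    t                          ∎
    where
    open ≡-Reasoning
    i = fromℕ< t<r
    wi≡e : w ⟨$⟩ˡ i ≡ e
    wi≡e = just-injective (trans (sym (right i))
                                 (subst (λ u → hor s u 0 ≡ just e) (sym (toℕ-fromℕ< t<r)) et))

  exitsAbove⇒w< : ∀ {k l} {k<l : toℕ k < toℕ l} → Pair.ExitsAbove k<l →
                  toℕ (w ⟨$⟩ʳ k) < toℕ (w ⟨$⟩ʳ l)
  exitsAbove⇒w< (Pair.exitRows tₖ<tₗ tₗ<r kExit lExit) =
    subst₂ _<_ (sym (w-exitRow (<-trans tₖ<tₗ tₗ<r) kExit)) (sym (w-exitRow tₗ<r lExit)) tₖ<tₗ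

  increasing-on-levels : ∀ a b → toℕ a < toℕ b → λ′ a ≡ λ′ b → toℕ (w ⟨$⟩ʳ a) < toℕ (w ⟨$⟩ʳ b)
  increasing-on-levels a b a<b λa≡λb = exitsAbove⇒w< (proj₂ (block⇒cross×exitsAbove a<b level))
    where
    level : ∀ m → toℕ a ≤ toℕ m → toℕ m ≤ toℕ b → λ′ m ≡ λ′ a
    level m a≤m m≤b = ≤-antisym (part a m a≤m) (subst (_≤ λ′ m) (sym λa≡λb) (part m b m≤b))

proposition6p2 : (r : ℕ) → 2 ≤ r → (λ′ : Fin r → ℕ) → IsPartition λ′ →
    (N : ℕ) → (∀ (z : Fin r) → toℕ z ≡ 0 → λ′ z + (r ∸ 1) ≤ N) → (w : Permutation′ r) →
    ((i j : Fin r) → (c : ℕ) → toℕ i < toℕ j →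
        (∀ (m : Fin r) → toℕ i ≤ toℕ m → toℕ m ≤ toℕ j → λ′ m ≡ c) →
        (s : State r) → Admissible r N λ′ w s →
        (k l : Fin r) → toℕ i ≤ toℕ k → toℕ k < toℕ l → toℕ l ≤ toℕ j →
        Cross r N s k l)
    × ((Σ (State r) (Admissible r N λ′ w)) → ShortestInCoset λ′ w)
proposition6p2 r _ λ′ part N hN w =
    (λ _ _ _ _ block s (vertex , top , _ , bottom , _ , right) _ _ i≤k k<l l≤j →
       proj₁ (AdmissibleState.block⇒cross×exitsAbove w s part hN vertex top bottom right k<l
                (λ m k≤m m≤l → block m (≤-trans i≤k k≤m) (≤-trans m≤l l≤j))))
  , λ (s , (vertex , top , _ , bottom , _ , right)) →
       shortestInCoset {w = w} part
         (AdmissibleState.increasing-on-levels w s part hN vertex top bottom right)
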